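{- Let $N$ be a positive integer and $L=\{f,c_1,\dots,c_N\}$ the language with one unary function symbol $f$ and constant symbols $c_1,\dots,c_N$. Let $\mathcal{T}_N$ be the $L$-theory stating that $c_i\neq c_j$ for $i\neq j$; that $f$ is a bijection from $M$ onto $M\setminus\{c_1,\dots,c_N\}$; and that for every integer $n\geq 1$, $\forall x\; f^n(x)\neq x$. Then $\mathcal{T}_N$ admits quantifier elimination.
   Context: $f^n$ denotes the $n$-th iterate of $f$. -}

module Defs where

open import Data.Nat using (ℕ; zero; suc; _≤_)
open import Data.Fin using (Fin; zero; suc)
open import Data.Product using (Σ; _×_; _,_)
open import Data.Sum using (_⊎_)
open import Data.Unit using (⊤)
open import Data.Empty using (⊥)
open import Relation.Nullary using (¬_)
open import Relation.Binary.PropositionalEquality using (_≡_)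
open import Function.Bundles using (_⇔_)

-- Terms and formulas are scoped:
-- a Term n / Formula n has its free variables among Fin n (de Bruijn).

data Term (N n : ℕ) : Set where
  var : Fin n → Term N n
  con : Fin N → Term N n
  app : Term N n → Term N n

iter : ∀ {N n} → ℕ → Term N n → Term N n
iter zero    t = t
iter (suc k) t = app (iter k t)

data Formula (N : ℕ) : ℕ → Set where
  ⊤ᶠ ⊥ᶠ : ∀ {n} → Formula N n
  _≐_   : ∀ {n} → Term N n → Term N n → Formula N n
  ¬ᶠ_   : ∀ {n} → Formula N n → Formula N n
  _∧ᶠ_ _∨ᶠ_ _⇒ᶠ_ : ∀ {n} → Formula N n → Formula N n → Formula N n
  ∃ᶠ ∀ᶠ : ∀ {n} → Formula N (suc n) → Formula N n

data IsQF {N : ℕ} : ∀ {n} → Formula N n → Set where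
  ⊤-qf : ∀ {n} → IsQF {n = n} ⊤ᶠ
  ⊥-qf : ∀ {n} → IsQF {n = n} ⊥ᶠ
  ≐-qf : ∀ {n} (s t : Term N n) → IsQF (s ≐ t)
  ¬-qf : ∀ {n} {φ : Formula N n} → IsQF φ → IsQF (¬ᶠ φ)
  ∧-qf : ∀ {n} {φ ψ : Formula N n} → IsQF φ → IsQF ψ → IsQF (φ ∧ᶠ ψ)
  ∨-qf : ∀ {n} {φ ψ : Formula N n} → IsQF φ → IsQF ψ → IsQF (φ ∨ᶠ ψ)
  ⇒-qf : ∀ {n} {φ ψ : Formula N n} → IsQF φ → IsQF ψ → IsQF (φ ⇒ᶠ ψ)

record Structure (N : ℕ) : Set₁ where
  field
    Carrier : Set
    fun     : Carrier → Carrier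
    const   : Fin N → Carrier

open Structure public

_∷ᵃ_ : ∀ {A : Set} {n} → A → (Fin n → A) → Fin (suc n) → A
(a ∷ᵃ ρ) zero    = a
(a ∷ᵃ ρ) (suc i) = ρ i

⟦_⟧ₜ : ∀ {N n} → Term N n → (M : Structure N) → (Fin n → Carrier M) → Carrier M
⟦ var i ⟧ₜ M ρ = ρ i
⟦ con c ⟧ₜ M ρ = const M c
⟦ app t ⟧ₜ M ρ = fun M (⟦ t ⟧ₜ M ρ)

-- Tarskian satisfaction, read classically via the Gödel–Gentzen
-- negative translation (equality, ∨ and ∃ are double-negated), so that
-- the semantics agrees with the classical model-theoretic one.
Sat : ∀ {N n} (M : Structure N) → (Fin n → Carrier M) → Formula N n → Set
Sat M ρ ⊤ᶠ        = ⊤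
Sat M ρ ⊥ᶠ        = ⊥
Sat M ρ (s ≐ t)   = ¬ ¬ (⟦ s ⟧ₜ M ρ ≡ ⟦ t ⟧ₜ M ρ)
Sat M ρ (¬ᶠ φ)    = ¬ Sat M ρ φ
Sat M ρ (φ ∧ᶠ ψ)  = Sat M ρ φ × Sat M ρ ψ
Sat M ρ (φ ∨ᶠ ψ)  = ¬ ¬ (Sat M ρ φ ⊎ Sat M ρ ψ)
Sat M ρ (φ ⇒ᶠ ψ)  = Sat M ρ φ → Sat M ρ ψ
Sat M ρ (∃ᶠ φ)    = ¬ ¬ (Σ (Carrier M) λ a → Sat M (a ∷ᵃ ρ) φ)
Sat M ρ (∀ᶠ φ)    = (a : Carrier M) → Sat M (a ∷ᵃ ρ) φ

⋀ : ∀ {N n} k → (Fin k → Formula N n) → Formula N n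
⋀ zero    φ = ⊤ᶠ
⋀ (suc k) φ = φ zero ∧ᶠ ⋀ k (λ i → φ (suc i))

x₀ x₁ : ∀ {N n} → Term N (suc (suc n))
x₀ = var zero
x₁ = var (suc zero)

v₀ : ∀ {N n} → Term N (suc n)
v₀ = var zero

data Axiom (N : ℕ) : Formula N 0 → Set where
  distinct  : (i j : Fin N) → ¬ (i ≡ j) → Axiom N (¬ᶠ (con i ≐ con j))
  injective : Axiom N (∀ᶠ (∀ᶠ ((app x₀ ≐ app x₁) ⇒ᶠ (x₀ ≐ x₁))))
  avoids    : Axiom N (∀ᶠ (⋀ N (λ i → ¬ᶠ (app v₀ ≐ con i))))
  onto      : Axiom N (∀ᶠ (⋀ N (λ i → ¬ᶠ (v₀ ≐ con i))
                          ⇒ᶠ ∃ᶠ (app x₀ ≐ x₁)))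
  acyclic   : (n : ℕ) → 1 ≤ n → Axiom N (∀ᶠ (¬ᶠ (iter n v₀ ≐ v₀)))

IsModel : ∀ {N} → Structure N → Set
IsModel {N} M = (φ : Formula N 0) → Axiom N φ → (ρ : Fin 0 → Carrier M) → Sat M ρ φ

AdmitsQE : ℕ → Set₁
AdmitsQE N = ∀ {n} (φ : Formula N n) →
  Σ (Formula N n) λ ψ → IsQF ψ ×
    ((M : Structure N) → IsModel M → (ρ : Fin n → Carrier M) →
      Sat M ρ φ ⇔ Sat M ρ ψ)

-- One existential quantifier is eliminated at a time, from ∃x ψ with ψ quantifier-free of term
-- depth ≤ K. If the witness z is close to a parameter p, i.e. f^a z = f^b p with a, b ≤ K, then
-- f^K z = f^e p for some e ≤ 2K; ψ(z) can be rewritten as a statement about f^K z, and lying in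
-- the range of f^K is quantifier-free (not being f^j c_i for any j < K). Otherwise z is far from
-- all parameters, and since f has no cycles all far points satisfy the same atomic formulas of
-- depth ≤ K. No two of the points f^(j(2K+1)) c on the orbit of a constant c are close to the
-- same parameter, so by pigeonhole one of them is far from all parameters and is a witness too.
-- Classical steps take place in the double-negation monad, matching the negative translation
-- used by Sat.

module Submission where

open import Defs
open import Data.Empty using (⊥-elim)
open import Data.Fin using (Fin; zero; suc; toℕ; fromℕ<; _↑ˡ_; _↑ʳ_; splitAt)
open import Data.Fin.Properties using (pigeonhole; splitAt-↑ˡ; splitAt-↑ʳ; toℕ<n; toℕ-fromℕ<)
open import Data.Maybe using (Maybe; nothing; just; maybe′)
open import Data.Nat using (ℕ; zero; suc; _+_; _*_; _∸_; _≤_; _<_; _⊔_; z≤n; s≤s)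
open import Data.Nat.GeneralisedArithmetic using (fold; fold-+)
open import Data.Nat.Properties
open import Data.Product using (∃; ∃-syntax; _×_; _,_; proj₁; proj₂; map₂)
open import Data.Product.Function.NonDependent.Propositional using (_×-⇔_)
open import Data.Sum using (inj₁; inj₂; [_,_]′)
open import Data.Sum.Function.Propositional using (_⊎-⇔_)
open import Data.Unit using (⊤; tt)
open import Effect.Monad using (RawMonad)
open import Function using (id; _∘_)
open import Function.Bundles using (_⇔_; mk⇔; Equivalence)
import Function.Properties.Equivalence as ⇔
open import Function.Related.TypeIsomorphisms using (¬-cong-⇔; →-cong-⇔)
open import Level using (0ℓ)
open import Relation.Binary.Definitions using (tri<; tri≈; tri>)
open import Relation.Binary.PropositionalEquality
open import Relation.Nullary using (¬_; Dec; yes; no)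
open import Relation.Nullary.Decidable using (¬¬-excluded-middle)
open import Relation.Nullary.Negation using (¬¬-Monad; Stable; negated-stable; ¬¬-map)

open Equivalence using (to; from)
open RawMonad (¬¬-Monad {0ℓ}) using (_>>=_; pure)

private
  variable
    N m n : ℕ
    A : Set
    P Q : A → Set

¬¬-cong-⇔ : {B C : Set} → B ⇔ C → (¬ ¬ B) ⇔ (¬ ¬ C)
¬¬-cong-⇔ = ¬-cong-⇔ ∘ ¬-cong-⇔

∃-cong-⇔ : (∀ a → P a ⇔ Q a) → ∃ P ⇔ ∃ Q
∃-cong-⇔ h = mk⇔ (map₂ (to (h _))) (map₂ (from (h _)))

Π-cong-⇔ : (∀ a → P a ⇔ Q a) → (∀ a → P a) ⇔ (∀ a → Q a)
Π-cong-⇔ h = mk⇔ (λ p a → to (h a) (p a)) (λ q a → from (h a) (q a))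

∀⇔¬¬¬∃¬ : (∀ a → Stable (P a)) → (∀ a → P a) ⇔ (¬ ¬ ¬ ∃ λ a → ¬ P a)
∀⇔¬¬¬∃¬ stable = mk⇔ (λ p h → h (λ (a , ¬pa) → ¬pa (p a)))
                     (λ h a → stable a (λ ¬pa → h (λ k → k (a , ¬pa))))

≡-cong-⇔ : {x x′ y y′ : A} → x ≡ x′ → y ≡ y′ → (x ≡ y) ⇔ (x′ ≡ y′)
≡-cong-⇔ refl refl = ⇔.refl

¬¬-finite-choice : {P : Fin n → Set} → (∀ i → ¬ ¬ P i) → ¬ ¬ (∀ i → P i)
¬¬-finite-choice {zero}  h = pure (λ ())
¬¬-finite-choice {suc n} h = do
  p₀ ← h zero
  ps ← ¬¬-finite-choice (h ∘ suc)
  pure λ { zero → p₀ ; (suc i) → ps i }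

depth : Term N n → ℕ
depth (var _) = 0
depth (con _) = 0
depth (app t) = suc (depth t)

-- Quantified subformulas are ignored (atomDepth, AllAtoms) or sent to ⊤ᶠ (mapTerms):
-- these are only ever applied to quantifier-free formulas.
atomDepth : Formula N n → ℕ
atomDepth (s ≐ t)  = depth s ⊔ depth t
atomDepth (¬ᶠ φ)   = atomDepth φ
atomDepth (φ ∧ᶠ ψ) = atomDepth φ ⊔ atomDepth ψ
atomDepth (φ ∨ᶠ ψ) = atomDepth φ ⊔ atomDepth ψ
atomDepth (φ ⇒ᶠ ψ) = atomDepth φ ⊔ atomDepth ψ
atomDepth _        = 0

AllAtoms : (Term N n → Term N n → Set) → Formula N n → Set
AllAtoms P (s ≐ t)  = P s t
AllAtoms P (¬ᶠ φ)   = AllAtoms P φ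
AllAtoms P (φ ∧ᶠ ψ) = AllAtoms P φ × AllAtoms P ψ
AllAtoms P (φ ∨ᶠ ψ) = AllAtoms P φ × AllAtoms P ψ
AllAtoms P (φ ⇒ᶠ ψ) = AllAtoms P φ × AllAtoms P ψ
AllAtoms P _        = ⊤

mapTerms : (Term N m → Term N n) → Formula N m → Formula N n
mapTerms g ⊤ᶠ       = ⊤ᶠ
mapTerms g ⊥ᶠ       = ⊥ᶠ
mapTerms g (s ≐ t)  = g s ≐ g t
mapTerms g (¬ᶠ φ)   = ¬ᶠ mapTerms g φ
mapTerms g (φ ∧ᶠ ψ) = mapTerms g φ ∧ᶠ mapTerms g ψ
mapTerms g (φ ∨ᶠ ψ) = mapTerms g φ ∨ᶠ mapTerms g ψ
mapTerms g (φ ⇒ᶠ ψ) = mapTerms g φ ⇒ᶠ mapTerms g ψ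
mapTerms g _        = ⊤ᶠ

module _ {P : Term N n → Term N n → Set} where

  allAtoms : (∀ s t → P s t) → {φ : Formula N n} → IsQF φ → AllAtoms P φ
  allAtoms p ⊤-qf       = tt
  allAtoms p ⊥-qf       = tt
  allAtoms p (≐-qf s t) = p s t
  allAtoms p (¬-qf q)   = allAtoms p q
  allAtoms p (∧-qf q r) = allAtoms p q , allAtoms p r
  allAtoms p (∨-qf q r) = allAtoms p q , allAtoms p r
  allAtoms p (⇒-qf q r) = allAtoms p q , allAtoms p r

allAtoms-depth : ∀ {K} {φ : Formula N n} → IsQF φ → atomDepth φ ≤ K →
                 AllAtoms (λ s t → depth s ≤ K × depth t ≤ K) φ
allAtoms-depth ⊤-qf       d = tt
allAtoms-depth ⊥-qf       d = tt
allAtoms-depth (≐-qf s t) d = m⊔n≤o⇒m≤o _ _ d , m⊔n≤o⇒n≤o _ _ d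
allAtoms-depth (¬-qf q)   d = allAtoms-depth q d
allAtoms-depth (∧-qf q r) d =
  allAtoms-depth q (m⊔n≤o⇒m≤o _ _ d) , allAtoms-depth r (m⊔n≤o⇒n≤o _ _ d)
allAtoms-depth (∨-qf q r) d =
  allAtoms-depth q (m⊔n≤o⇒m≤o _ _ d) , allAtoms-depth r (m⊔n≤o⇒n≤o _ _ d)
allAtoms-depth (⇒-qf q r) d =
  allAtoms-depth q (m⊔n≤o⇒m≤o _ _ d) , allAtoms-depth r (m⊔n≤o⇒n≤o _ _ d)

module _ (g : Term N m → Term N n) where

  mapTerms-qf : {φ : Formula N m} → IsQF φ → IsQF (mapTerms g φ)
  mapTerms-qf ⊤-qf       = ⊤-qf
  mapTerms-qf ⊥-qf       = ⊥-qf
  mapTerms-qf (≐-qf s t) = ≐-qf (g s) (g t)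
  mapTerms-qf (¬-qf q)   = ¬-qf (mapTerms-qf q)
  mapTerms-qf (∧-qf q r) = ∧-qf (mapTerms-qf q) (mapTerms-qf r)
  mapTerms-qf (∨-qf q r) = ∨-qf (mapTerms-qf q) (mapTerms-qf r)
  mapTerms-qf (⇒-qf q r) = ⇒-qf (mapTerms-qf q) (mapTerms-qf r)

mapTerms-id : {φ : Formula N n} → IsQF φ → mapTerms id φ ≡ φ
mapTerms-id ⊤-qf       = refl
mapTerms-id ⊥-qf       = refl
mapTerms-id (≐-qf s t) = refl
mapTerms-id (¬-qf q)   = cong ¬ᶠ_ (mapTerms-id q)
mapTerms-id (∧-qf q r) = cong₂ _∧ᶠ_ (mapTerms-id q) (mapTerms-id r)
mapTerms-id (∨-qf q r) = cong₂ _∨ᶠ_ (mapTerms-id q) (mapTerms-id r)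
mapTerms-id (⇒-qf q r) = cong₂ _⇒ᶠ_ (mapTerms-id q) (mapTerms-id r)

⋁ : ∀ k → (Fin k → Formula N n) → Formula N n
⋁ zero    φ = ⊥ᶠ
⋁ (suc k) φ = φ zero ∨ᶠ ⋁ k (φ ∘ suc)

⋀-qf : ∀ k {φ : Fin k → Formula N n} → (∀ i → IsQF (φ i)) → IsQF (⋀ k φ)
⋀-qf zero    q = ⊤-qf
⋀-qf (suc k) q = ∧-qf (q zero) (⋀-qf k (q ∘ suc))

⋁-qf : ∀ k {φ : Fin k → Formula N n} → (∀ i → IsQF (φ i)) → IsQF (⋁ k φ)
⋁-qf zero    q = ⊥-qf
⋁-qf (suc k) q = ∨-qf (q zero) (⋁-qf k (q ∘ suc))

module _ {M : Structure N} where

  Sat-stable : {ρ : Fin n → Carrier M} (φ : Formula N n) → Stable (Sat M ρ φ)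
  Sat-stable ⊤ᶠ       h = tt
  Sat-stable ⊥ᶠ       h = h id
  Sat-stable (s ≐ t)  h = negated-stable h
  Sat-stable (¬ᶠ φ)   h = negated-stable h
  Sat-stable (φ ∧ᶠ ψ) h = Sat-stable φ (¬¬-map proj₁ h) , Sat-stable ψ (¬¬-map proj₂ h)
  Sat-stable (φ ∨ᶠ ψ) h = negated-stable h
  Sat-stable (φ ⇒ᶠ ψ) h = λ a → Sat-stable ψ (¬¬-map (λ g → g a) h)
  Sat-stable (∃ᶠ φ)   h = negated-stable h
  Sat-stable (∀ᶠ φ)   h = λ a → Sat-stable φ (¬¬-map (λ g → g a) h)

  ⋀-sat : {ρ : Fin n → Carrier M} (k : ℕ) (φ : Fin k → Formula N n) →
          Sat M ρ (⋀ k φ) ⇔ (∀ i → Sat M ρ (φ i))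
  ⋀-sat zero    φ = mk⇔ (λ _ ()) (λ _ → tt)
  ⋀-sat (suc k) φ = mk⇔
    (λ (s₀ , s) → λ { zero → s₀ ; (suc i) → to (⋀-sat k (φ ∘ suc)) s i })
    (λ s → s zero , from (⋀-sat k (φ ∘ suc)) (s ∘ suc))

  ⋁-sat : {ρ : Fin n → Carrier M} (k : ℕ) (φ : Fin k → Formula N n) →
          Sat M ρ (⋁ k φ) ⇔ (¬ ¬ ∃ λ i → Sat M ρ (φ i))
  ⋁-sat zero    φ = mk⇔ (λ ()) (λ h → h (λ ()))
  ⋁-sat (suc k) φ = mk⇔
    (λ s → s >>= [ (λ s₀ → pure (zero , s₀))
                 , (λ s′ → to (⋁-sat k (φ ∘ suc)) s′ >>= λ (i , sᵢ) → pure (suc i , sᵢ)) ]′)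
    (λ h → h >>= λ { (zero , s₀) → pure (inj₁ s₀)
                   ; (suc i , sᵢ) → pure (inj₂ (from (⋁-sat k (φ ∘ suc)) (pure (i , sᵢ)))) })

  module _ {ρ : Fin m → Carrier M} {σ : Fin n → Carrier M}
           {P : Term N m → Term N m → Set} (g : Term N m → Term N n)
           (atom : ∀ {s t} → P s t → Sat M σ (g s ≐ g t) ⇔ Sat M ρ (s ≐ t)) where

    mapTerms-sat-AllAtoms : {φ : Formula N m} → IsQF φ → AllAtoms P φ →
                            Sat M σ (mapTerms g φ) ⇔ Sat M ρ φ
    mapTerms-sat-AllAtoms ⊤-qf       _        = ⇔.refl
    mapTerms-sat-AllAtoms ⊥-qf       _        = ⇔.refl
    mapTerms-sat-AllAtoms (≐-qf s t) p        = atom p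
    mapTerms-sat-AllAtoms (¬-qf q)   p        = ¬-cong-⇔ (mapTerms-sat-AllAtoms q p)
    mapTerms-sat-AllAtoms (∧-qf q r) (p , p′) =
      mapTerms-sat-AllAtoms q p ×-⇔ mapTerms-sat-AllAtoms r p′
    mapTerms-sat-AllAtoms (∨-qf q r) (p , p′) =
      ¬¬-cong-⇔ (mapTerms-sat-AllAtoms q p ⊎-⇔ mapTerms-sat-AllAtoms r p′)
    mapTerms-sat-AllAtoms (⇒-qf q r) (p , p′) =
      →-cong-⇔ (mapTerms-sat-AllAtoms q p) (mapTerms-sat-AllAtoms r p′)

  mapTerms-sat : {ρ : Fin m → Carrier M} {σ : Fin n → Carrier M} (g : Term N m → Term N n) →
                 (∀ s t → Sat M σ (g s ≐ g t) ⇔ Sat M ρ (s ≐ t)) →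
                 {φ : Formula N m} → IsQF φ → Sat M σ (mapTerms g φ) ⇔ Sat M ρ φ
  mapTerms-sat g atom q =
    mapTerms-sat-AllAtoms {P = λ _ _ → ⊤} g (λ {s} {t} _ → atom s t) q (allAtoms (λ _ _ → tt) q)

  Sat-qf-cong : {ρ σ : Fin n → Carrier M} {P : Term N n → Term N n → Set} →
                (∀ {s t} → P s t → Sat M σ (s ≐ t) ⇔ Sat M ρ (s ≐ t)) →
                {φ : Formula N n} → IsQF φ → AllAtoms P φ → Sat M σ φ ⇔ Sat M ρ φ
  Sat-qf-cong {ρ = ρ} {σ} atom q p =
    subst (λ φ → Sat M σ φ ⇔ Sat M ρ _) (mapTerms-id q) (mapTerms-sat-AllAtoms id atom q p)

-- The parameters of a formula in n free variables are its variables followed by the constants.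
param : Fin (n + N) → Term N n
param {n} k = [ var , con ]′ (splitAt n k)

-- Every term in x₀ and the parameters is f^(depth t) of x₀ (nothing) or of a parameter.
base : Term N (suc n) → Maybe (Fin (n + N))
base (var zero)            = nothing
base {N} (var (suc i))     = just (i ↑ˡ N)
base {n = n} (con c)       = just (n ↑ʳ c)
base (app t)               = base t

sub₀ : Term N n → Term N (suc n) → Term N n
sub₀ u (var zero)    = u
sub₀ u (var (suc i)) = var i
sub₀ u (con c)       = con c
sub₀ u (app t)       = app (sub₀ u t)

sub₀ᶠ : Term N n → Formula N (suc n) → Formula N n
sub₀ᶠ u = mapTerms (sub₀ u)

shiftParams : ℕ → Term N (suc n) → Term N (suc n)
shiftParams K (var zero)    = var zero
shiftParams K (var (suc i)) = iter K (var (suc i))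
shiftParams K (con c)       = iter K (con c)
shiftParams K (app t)       = app (shiftParams K t)

shiftParamsᶠ : ℕ → Formula N (suc n) → Formula N (suc n)
shiftParamsᶠ K = mapTerms (shiftParams K)

-- w is in the range of f^K iff it is not of the form f^j c_i with j < K.
inRange : ℕ → Term N n → Formula N n
inRange {N} K w = ⋀ K λ j → ⋀ N λ i → ¬ᶠ (w ≐ iter (toℕ j) (con i))

-- ψ has a witness z with f^K z = w.
nearWitnessVia : ℕ → Formula N (suc n) → Term N n → Formula N n
nearWitnessVia K ψ w = inRange K w ∧ᶠ sub₀ᶠ w (shiftParamsᶠ K ψ)

nearWitnessAt : ℕ → Formula N (suc n) → Fin (n + N) → Formula N n
nearWitnessAt K ψ k = ⋁ (suc (K + K)) λ e → nearWitnessVia K ψ (iter (toℕ e) (param k))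

nearWitness : ℕ → Formula N (suc n) → Formula N n
nearWitness {N} {n} K ψ = ⋁ (n + N) (nearWitnessAt K ψ)

farPoint : Fin N → ℕ → Fin m → Term N n
farPoint c K j = iter (toℕ j * suc (K + K)) (con c)

farWitness : Fin N → ℕ → Formula N (suc n) → Formula N n
farWitness {N} {n} c K ψ = ⋁ (suc (n + N)) λ j → sub₀ᶠ (farPoint c K j) ψ

elim : Fin N → Formula N (suc n) → Formula N n
elim c ψ = nearWitness (atomDepth ψ) ψ ∨ᶠ farWitness c (atomDepth ψ) ψ

inRange-qf : ∀ K (w : Term N n) → IsQF (inRange K w)
inRange-qf {N} K w = ⋀-qf K λ j → ⋀-qf N λ i → ¬-qf (≐-qf w (iter (toℕ j) (con i)))

elim-qf : (c : Fin N) {ψ : Formula N (suc n)} → IsQF ψ → IsQF (elim c ψ)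
elim-qf {N} {n} c {ψ} q = ∨-qf
  (⋁-qf (n + N) λ k → ⋁-qf (suc (K + K)) λ e → let w = iter (toℕ e) (param k) in
     ∧-qf (inRange-qf K w) (mapTerms-qf (sub₀ w) (mapTerms-qf (shiftParams K) q)))
  (⋁-qf (suc (n + N)) λ j → mapTerms-qf (sub₀ (farPoint c K j)) q)
  where
  K = atomDepth ψ

qe : Fin N → Formula N n → Formula N n
qe c ⊤ᶠ       = ⊤ᶠ
qe c ⊥ᶠ       = ⊥ᶠ
qe c (s ≐ t)  = s ≐ t
qe c (¬ᶠ φ)   = ¬ᶠ qe c φ
qe c (φ ∧ᶠ ψ) = qe c φ ∧ᶠ qe c ψ
qe c (φ ∨ᶠ ψ) = qe c φ ∨ᶠ qe c ψ
qe c (φ ⇒ᶠ ψ) = qe c φ ⇒ᶠ qe c ψ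
qe c (∃ᶠ φ)   = elim c (qe c φ)
qe c (∀ᶠ φ)   = ¬ᶠ elim c (¬ᶠ qe c φ)

qe-qf : (c : Fin N) (φ : Formula N n) → IsQF (qe c φ)
qe-qf c ⊤ᶠ       = ⊤-qf
qe-qf c ⊥ᶠ       = ⊥-qf
qe-qf c (s ≐ t)  = ≐-qf s t
qe-qf c (¬ᶠ φ)   = ¬-qf (qe-qf c φ)
qe-qf c (φ ∧ᶠ ψ) = ∧-qf (qe-qf c φ) (qe-qf c ψ)
qe-qf c (φ ∨ᶠ ψ) = ∨-qf (qe-qf c φ) (qe-qf c ψ)
qe-qf c (φ ⇒ᶠ ψ) = ⇒-qf (qe-qf c φ) (qe-qf c ψ)
qe-qf c (∃ᶠ φ)   = elim-qf c (qe-qf c φ)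
qe-qf c (∀ᶠ φ)   = ¬-qf (elim-qf c (¬-qf (qe-qf c φ)))

u+i*[1+2K]<v+j*[1+2K] : ∀ {K u v i j} → u ≤ K + K → i < j →
                         u + i * suc (K + K) < v + j * suc (K + K)
u+i*[1+2K]<v+j*[1+2K] {K} {u} {v} {i} {j} u≤2K i<j = begin-strict
  u + i * S       ≤⟨ +-monoˡ-≤ (i * S) u≤2K ⟩
  (K + K) + i * S <⟨ n<1+n _ ⟩
  suc i * S       ≤⟨ *-monoˡ-≤ S i<j ⟩
  j * S           ≤⟨ m≤n+m (j * S) v ⟩
  v + j * S       ∎
  where
  open ≤-Reasoning
  S = suc (K + K)

module Model (M : Structure N) (M⊨T : IsModel M) where

  private
    C = Carrier M
    f = fun M
    ρ₀ : Fin 0 → C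
    ρ₀ ()

  f^ : ℕ → C → C
  f^ k x = fold x f k

  f^-+ : ∀ a b x → f^ a (f^ b x) ≡ f^ (a + b) x
  f^-+ a b x = sym (fold-+ x f a)

  f^-comm-f : ∀ a x → f^ a (f x) ≡ f (f^ a x)
  f^-comm-f a x = trans (f^-+ a 1 x) (cong (λ k → f^ k x) (+-comm a 1))

  ⟦iter⟧ : ∀ {ρ : Fin n → C} k (t : Term N n) → ⟦ iter k t ⟧ₜ M ρ ≡ f^ k (⟦ t ⟧ₜ M ρ)
  ⟦iter⟧ zero    t = refl
  ⟦iter⟧ (suc k) t = cong f (⟦iter⟧ k t)

  f-injective : ∀ {x y} → f x ≡ f y → ¬ ¬ x ≡ y
  f-injective {x} {y} e = M⊨T _ injective ρ₀ y x (λ ¬e → ¬e e)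

  f≢const : ∀ {y} i → f y ≢ const M i
  f≢const {y} i e = to (⋀-sat N _) (M⊨T _ avoids ρ₀ y) i (λ ¬e → ¬e e)

  f-onto : ∀ {x} → (∀ i → x ≢ const M i) → ¬ ¬ ∃ λ y → f y ≡ x
  f-onto {x} x≢c k = M⊨T _ onto ρ₀ x (from (⋀-sat N _) λ i ¬¬e → ¬¬e (x≢c i))
    (λ (y , ¬¬e) → ¬¬e λ e → k (y , e))

  f^-acyclic : ∀ d x → f^ (suc d) x ≢ x
  f^-acyclic d x e = M⊨T _ (acyclic (suc d) (s≤s z≤n)) ρ₀ x
    (λ ¬e → ¬e (trans (⟦iter⟧ (suc d) (var zero)) e))

  f^-injective : ∀ k {x y} → f^ k x ≡ f^ k y → ¬ ¬ x ≡ y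
  f^-injective zero    e = pure e
  f^-injective (suc k) e = f-injective e >>= f^-injective k

  ¬¬f^-cancel : ∀ k {x y} → (¬ ¬ f^ k x ≡ f^ k y) ⇔ (¬ ¬ x ≡ y)
  ¬¬f^-cancel k = mk⇔ (_>>= f^-injective k) (¬¬-map (cong (f^ k)))

  f^-<-≢ : ∀ {a b x} → a < b → f^ a x ≢ f^ b x
  f^-<-≢ {a} {b} {x} a<b e with m≤n⇒∃[o]m+o≡n a<b
  ... | o , refl = f^-acyclic o (f^ a x) (begin
    f^ (suc o) (f^ a x) ≡⟨ f^-+ (suc o) a x ⟩
    f^ (suc o + a) x    ≡⟨ cong (λ k → f^ (suc k) x) (+-comm o a) ⟩
    f^ (suc a + o) x    ≡⟨ sym e ⟩
    f^ a x              ∎)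
    where open ≡-Reasoning

  f^-exponent-injective : ∀ {a b} x → f^ a x ≡ f^ b x → a ≡ b
  f^-exponent-injective {a} {b} x e with <-cmp a b
  ... | tri< a<b _ _ = ⊥-elim (f^-<-≢ a<b e)
  ... | tri≈ _ a≡b _ = a≡b
  ... | tri> _ _ b<a = ⊥-elim (f^-<-≢ b<a (sym e))

  f^-exponent-⇔ : ∀ {a b} x → (f^ a x ≡ f^ b x) ⇔ (a ≡ b)
  f^-exponent-⇔ x = mk⇔ (f^-exponent-injective x) (cong (λ k → f^ k x))

  f^-collision⇒∈range : ∀ {j K z x} → j < K → f^ K z ≡ f^ j x → ¬ ¬ ∃ λ y → f y ≡ x
  f^-collision⇒∈range {zero}  {suc K} {z} _         e = pure (f^ K z , e)
  f^-collision⇒∈range {suc j} {suc K}     (s≤s j<K) e = f-injective e >>= f^-collision⇒∈range j<K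

  f^≢const-orbit : ∀ {j K z} i → j < K → f^ K z ≢ f^ j (const M i)
  f^≢const-orbit i j<K e = f^-collision⇒∈range j<K e λ (y , fy≡c) → f≢const i fy≡c

  ∈range-f^ : ∀ K {x} → (∀ (j : Fin K) i → x ≢ f^ (toℕ j) (const M i)) → ¬ ¬ ∃ λ z → f^ K z ≡ x
  ∈range-f^ zero    {x} _   = pure (x , refl)
  ∈range-f^ (suc K)     x∉ = do
    y , fy≡x ← f-onto (x∉ zero)
    z , e    ← ∈range-f^ K (λ j i e′ → x∉ (suc j) i (trans (sym fy≡x) (cong f e′)))
    pure (z , trans (cong f e) fy≡x)

  inRange-sat : ∀ {ρ : Fin n → C} K (w : Term N n) →
                Sat M ρ (inRange K w) ⇔ (¬ ¬ ∃ λ z → f^ K z ≡ ⟦ w ⟧ₜ M ρ)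
  inRange-sat K w = mk⇔
    (λ s → ∈range-f^ K λ j i e → to (⋀-sat N _) (to (⋀-sat K _) s j) i
      (λ ¬e → ¬e (trans e (sym (⟦iter⟧ (toℕ j) (con i))))))
    (λ h → from (⋀-sat K _) λ j → from (⋀-sat N _) λ i ¬¬e → h λ (z , fz≡w) →
      ¬¬e λ e → f^≢const-orbit i (toℕ<n j) (trans fz≡w (trans e (⟦iter⟧ (toℕ j) (con i)))))

  ⟦sub₀⟧ : ∀ {ρ : Fin n → C} u (t : Term N (suc n)) →
           ⟦ sub₀ u t ⟧ₜ M ρ ≡ ⟦ t ⟧ₜ M (⟦ u ⟧ₜ M ρ ∷ᵃ ρ)
  ⟦sub₀⟧ u (var zero)    = refl
  ⟦sub₀⟧ u (var (suc i)) = refl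
  ⟦sub₀⟧ u (con c)       = refl
  ⟦sub₀⟧ u (app t)       = cong f (⟦sub₀⟧ u t)

  sub₀-sat : ∀ {ρ : Fin n → C} u {φ} → IsQF φ → Sat M ρ (sub₀ᶠ u φ) ⇔ Sat M (⟦ u ⟧ₜ M ρ ∷ᵃ ρ) φ
  sub₀-sat u = mapTerms-sat (sub₀ u) λ s t → ¬¬-cong-⇔ (≡-cong-⇔ (⟦sub₀⟧ u s) (⟦sub₀⟧ u t))

  ⟦shiftParams⟧ : ∀ {ρ : Fin n → C} K z (t : Term N (suc n)) →
                  ⟦ shiftParams K t ⟧ₜ M (f^ K z ∷ᵃ ρ) ≡ f^ K (⟦ t ⟧ₜ M (z ∷ᵃ ρ))
  ⟦shiftParams⟧ K z (var zero)    = refl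
  ⟦shiftParams⟧ K z (var (suc i)) = ⟦iter⟧ K (var (suc i))
  ⟦shiftParams⟧ K z (con c)       = ⟦iter⟧ K (con c)
  ⟦shiftParams⟧ K z (app t)       = trans (cong f (⟦shiftParams⟧ K z t)) (sym (f^-comm-f K _))

  shiftParams-sat : ∀ {ρ : Fin n → C} K z {φ} → IsQF φ →
                    Sat M (f^ K z ∷ᵃ ρ) (shiftParamsᶠ K φ) ⇔ Sat M (z ∷ᵃ ρ) φ
  shiftParams-sat K z = mapTerms-sat (shiftParams K) λ s t →
    ⇔.trans (¬¬-cong-⇔ (≡-cong-⇔ (⟦shiftParams⟧ K z s) (⟦shiftParams⟧ K z t))) (¬¬f^-cancel K)

  Close : ℕ → C → C → Set
  Close K y x = ∃[ a ] ∃[ b ] a ≤ K × b ≤ K × f^ a x ≡ f^ b y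

  Far : ℕ → (Fin m → C) → C → Set
  Far K α x = ∀ k → ¬ Close K (α k) x

  close⇒f^-on-orbit : ∀ {K y z} → Close K y z → ∃[ e ] e < suc (K + K) × f^ K z ≡ f^ e y
  close⇒f^-on-orbit {K} {y} {z} (a , b , a≤K , b≤K , e) =
    K ∸ a + b , s≤s (+-mono-≤ (m∸n≤m K a) b≤K) , (begin
      f^ K z                 ≡⟨ cong (λ k → f^ k z) (sym (m∸n+n≡m a≤K)) ⟩
      f^ (K ∸ a + a) z       ≡⟨ sym (f^-+ (K ∸ a) a z) ⟩
      f^ (K ∸ a) (f^ a z)    ≡⟨ cong (f^ (K ∸ a)) e ⟩
      f^ (K ∸ a) (f^ b y)    ≡⟨ f^-+ (K ∸ a) b y ⟩
      f^ (K ∸ a + b) y       ∎)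
    where open ≡-Reasoning

  -- Otherwise f^u c = f^v c with u ≤ 2K + i(2K+1) < v, contradicting acyclicity.
  orbit-spaced : ∀ {K y c i j} → i < j →
                 Close K y (f^ (i * suc (K + K)) c) → ¬ Close K y (f^ (j * suc (K + K)) c)
  orbit-spaced {K} {y} {c} {i} {j} i<j (a , b , a≤K , b≤K , e) (a′ , b′ , a′≤K , b′≤K , e′) =
    <⇒≢ (u+i*[1+2K]<v+j*[1+2K] {K} {v = b + a′} (+-mono-≤ b′≤K a≤K) i<j)
        (f^-exponent-injective c same-point)
    where
    open ≡-Reasoning
    iS = i * suc (K + K)
    jS = j * suc (K + K)
    same-point : f^ (b′ + a + iS) c ≡ f^ (b + a′ + jS) c
    same-point = begin
      f^ (b′ + a + iS) c     ≡⟨ sym (f^-+ (b′ + a) iS c) ⟩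
      f^ (b′ + a) (f^ iS c)  ≡⟨ sym (f^-+ b′ a _) ⟩
      f^ b′ (f^ a (f^ iS c)) ≡⟨ cong (f^ b′) e ⟩
      f^ b′ (f^ b y)         ≡⟨ f^-+ b′ b y ⟩
      f^ (b′ + b) y          ≡⟨ cong (λ k → f^ k y) (+-comm b′ b) ⟩
      f^ (b + b′) y          ≡⟨ sym (f^-+ b b′ y) ⟩
      f^ b (f^ b′ y)         ≡⟨ cong (f^ b) (sym e′) ⟩
      f^ b (f^ a′ (f^ jS c)) ≡⟨ f^-+ b a′ _ ⟩
      f^ (b + a′) (f^ jS c)  ≡⟨ f^-+ (b + a′) jS c ⟩
      f^ (b + a′ + jS) c     ∎

  far-orbit-point : ∀ K (α : Fin m → C) c →
                    ¬ ¬ ∃ λ (j : Fin (suc m)) → Far K α (f^ (toℕ j * suc (K + K)) c)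
  far-orbit-point {m} K α c noneFar =
    ¬¬-finite-choice (λ j noneClose → noneFar (j , λ k cl → noneClose (k , cl))) λ close →
      let i , j , i<j , same = pigeonhole (n<1+n m) (proj₁ ∘ close) in
      orbit-spaced i<j (proj₂ (close i))
        (subst (λ k → Close K (α k) (f^ (toℕ j * suc (K + K)) c)) (sym same) (proj₂ (close j)))

  module _ {n} (ρ : Fin n → C) where

    params : Fin (n + N) → C
    params k = ⟦ param k ⟧ₜ M ρ

    ⟦⟧-base : ∀ (t : Term N (suc n)) z → ⟦ t ⟧ₜ M (z ∷ᵃ ρ) ≡ f^ (depth t) (maybe′ params z (base t))
    ⟦⟧-base (var zero)    z = refl
    ⟦⟧-base (var (suc i)) z = cong (λ s → ⟦ [ var , con ]′ s ⟧ₜ M ρ) (sym (splitAt-↑ˡ n i N))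
    ⟦⟧-base (con c)       z = cong (λ s → ⟦ [ var , con ]′ s ⟧ₜ M ρ) (sym (splitAt-↑ʳ n N c))
    ⟦⟧-base (app t)       z = cong f (⟦⟧-base t z)

    far-base-cong : ∀ {K z z′ a b} → Far K params z → Far K params z′ → a ≤ K → b ≤ K → ∀ p q →
      (¬ ¬ f^ a (maybe′ params z′ p) ≡ f^ b (maybe′ params z′ q)) ⇔
      (¬ ¬ f^ a (maybe′ params z p) ≡ f^ b (maybe′ params z q))
    far-base-cong {z = z} {z′} {a} {b} far far′ a≤K b≤K nothing nothing =
      ¬¬-cong-⇔ (⇔.trans (f^-exponent-⇔ {a} {b} z′) (⇔.sym (f^-exponent-⇔ z)))
    far-base-cong far far′ a≤K b≤K nothing (just k) = mk⇔
      (λ h → ⊥-elim (h λ e → far′ k (_ , _ , a≤K , b≤K , e)))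
      (λ h → ⊥-elim (h λ e → far k (_ , _ , a≤K , b≤K , e)))
    far-base-cong far far′ a≤K b≤K (just k) nothing = mk⇔
      (λ h → ⊥-elim (h λ e → far′ k (_ , _ , b≤K , a≤K , sym e)))
      (λ h → ⊥-elim (h λ e → far k (_ , _ , b≤K , a≤K , sym e)))
    far-base-cong far far′ a≤K b≤K (just k) (just l) = ⇔.refl

    far-indistinguishable : ∀ {K z z′} {φ : Formula N (suc n)} → Far K params z → Far K params z′ →
                            IsQF φ → atomDepth φ ≤ K → Sat M (z′ ∷ᵃ ρ) φ ⇔ Sat M (z ∷ᵃ ρ) φ
    far-indistinguishable {z = z} {z′} far far′ q d = Sat-qf-cong atom q (allAtoms-depth q d)
      where
      atom : ∀ {s t} → depth s ≤ _ × depth t ≤ _ → Sat M (z′ ∷ᵃ ρ) (s ≐ t) ⇔ Sat M (z ∷ᵃ ρ) (s ≐ t)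
      atom {s} {t} (ds , dt)
        rewrite ⟦⟧-base s z | ⟦⟧-base t z | ⟦⟧-base s z′ | ⟦⟧-base t z′ =
        far-base-cong far far′ ds dt (base s) (base t)

    module _ {ψ : Formula N (suc n)} (q : IsQF ψ) where

      shifted-sat : ∀ {K z} w → f^ K z ≡ ⟦ w ⟧ₜ M ρ →
                    Sat M ρ (sub₀ᶠ w (shiftParamsᶠ K ψ)) ⇔ Sat M (z ∷ᵃ ρ) ψ
      shifted-sat {K} {z} w fᴷz≡w =
        ⇔.trans (sub₀-sat w (mapTerms-qf (shiftParams K) q))
                (subst (λ x → Sat M (x ∷ᵃ ρ) (shiftParamsᶠ K ψ) ⇔ _) fᴷz≡w (shiftParams-sat K z q))

      nearWitness-sound : ∀ {K} → Sat M ρ (nearWitness K ψ) → ¬ ¬ ∃ λ z → Sat M (z ∷ᵃ ρ) ψ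
      nearWitness-sound {K} s = do
        k , sₖ            ← to (⋁-sat (n + N) (nearWitnessAt K ψ)) s
        e , inR , shifted ← to (⋁-sat (suc (K + K)) λ e →
                                 nearWitnessVia K ψ (iter (toℕ e) (param k))) sₖ
        z , fᴷz≡w         ← to (inRange-sat K _) inR
        pure (z , to (shifted-sat _ fᴷz≡w) shifted)

      nearWitness-complete : ∀ {K k z} → Close K (params k) z → Sat M (z ∷ᵃ ρ) ψ →
                             Sat M ρ (nearWitness K ψ)
      nearWitness-complete {K} {k} {z} close s =
        from (⋁-sat (n + N) (nearWitnessAt K ψ)) (pure (k ,
          from (⋁-sat (suc (K + K)) λ e → nearWitnessVia K ψ (iter (toℕ e) (param k)))
            (pure (fromℕ< e<S , from (inRange-sat K w) (pure (z , fᴷz≡w)) ,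
                                from (shifted-sat w fᴷz≡w) s))))
        where
        open ≡-Reasoning
        e = proj₁ (close⇒f^-on-orbit close)
        e<S = proj₁ (proj₂ (close⇒f^-on-orbit close))
        w = iter (toℕ (fromℕ< e<S)) (param k)
        fᴷz≡w : f^ K z ≡ ⟦ w ⟧ₜ M ρ
        fᴷz≡w = begin
          f^ K z                           ≡⟨ proj₂ (proj₂ (close⇒f^-on-orbit close)) ⟩
          f^ e (params k)                  ≡⟨ cong (λ i → f^ i (params k)) (sym (toℕ-fromℕ< e<S)) ⟩
          f^ (toℕ (fromℕ< e<S)) (params k) ≡⟨ sym (⟦iter⟧ (toℕ (fromℕ< e<S)) (param k)) ⟩
          ⟦ w ⟧ₜ M ρ                       ∎

      farWitness-sound : ∀ c K → Sat M ρ (farWitness c K ψ) → ¬ ¬ ∃ λ z → Sat M (z ∷ᵃ ρ) ψ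
      farWitness-sound c K s = do
        j , sⱼ ← to (⋁-sat (suc (n + N)) λ j → sub₀ᶠ (farPoint c K j) ψ) s
        pure (_ , to (sub₀-sat _ q) sⱼ)

      farWitness-complete : ∀ {c z} → Far (atomDepth ψ) params z → Sat M (z ∷ᵃ ρ) ψ →
                            Sat M ρ (farWitness c (atomDepth ψ) ψ)
      farWitness-complete {c} {z} far s =
        from (⋁-sat (suc (n + N)) λ j → sub₀ᶠ (farPoint c K j) ψ) do
          j , far′ ← far-orbit-point K params (const M c)
          let z′≡⟦farPoint⟧ = sym (⟦iter⟧ (toℕ j * suc (K + K)) (con c))
          pure (j , from (sub₀-sat _ q)
            (subst (λ x → Sat M (x ∷ᵃ ρ) ψ) z′≡⟦farPoint⟧
              (from (far-indistinguishable {K = K} far far′ q ≤-refl) s)))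
        where
        K = atomDepth ψ

      elim-correct : ∀ {c} → Sat M ρ (elim c ψ) ⇔ (¬ ¬ ∃ λ z → Sat M (z ∷ᵃ ρ) ψ)
      elim-correct {c} =
        mk⇔ (_>>= [ nearWitness-sound , farWitness-sound c (atomDepth ψ) ]′) λ h → do
          z , s ← h
          farOrNot ← ¬¬-excluded-middle
          witness s farOrNot
        where
        witness : ∀ {z} → Sat M (z ∷ᵃ ρ) ψ → Dec (Far (atomDepth ψ) params z) →
                  Sat M ρ (elim c ψ)
        witness s (yes far) = pure (inj₂ (farWitness-complete far s))
        witness s (no ¬far) = do
          k , close ← λ noneClose → ¬far λ k close → noneClose (k , close)
          pure (inj₁ (nearWitness-complete close s))

  qe-correct : ∀ c (φ : Formula N n) {ρ : Fin n → C} → Sat M ρ φ ⇔ Sat M ρ (qe c φ)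
  qe-correct c ⊤ᶠ       = ⇔.refl
  qe-correct c ⊥ᶠ       = ⇔.refl
  qe-correct c (s ≐ t)  = ⇔.refl
  qe-correct c (¬ᶠ φ)   = ¬-cong-⇔ (qe-correct c φ)
  qe-correct c (φ ∧ᶠ ψ) = qe-correct c φ ×-⇔ qe-correct c ψ
  qe-correct c (φ ∨ᶠ ψ) = ¬¬-cong-⇔ (qe-correct c φ ⊎-⇔ qe-correct c ψ)
  qe-correct c (φ ⇒ᶠ ψ) = →-cong-⇔ (qe-correct c φ) (qe-correct c ψ)
  qe-correct c (∃ᶠ φ) {ρ} =
    ⇔.trans (¬¬-cong-⇔ (∃-cong-⇔ λ _ → qe-correct c φ)) (⇔.sym (elim-correct ρ (qe-qf c φ)))
  qe-correct c (∀ᶠ φ) {ρ} =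
    ⇔.trans (Π-cong-⇔ λ _ → qe-correct c φ)
      (⇔.trans (∀⇔¬¬¬∃¬ λ _ → Sat-stable (qe c φ))
        (¬-cong-⇔ (⇔.sym (elim-correct ρ (¬-qf (qe-qf c φ))))))

proposition3p1 : (N : ℕ) → 1 ≤ N → AdmitsQE N
proposition3p1 N 0<N φ =
  qe c φ , qe-qf c φ , λ M M⊨T ρ → Model.qe-correct M M⊨T c φ
  where
  c = fromℕ< 0<N
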